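{- Let $f(x,y)=\frac{4}{x}-\frac{8}{x+1}+\frac{2}{x+2}+\frac{4}{y}-\frac{8}{y+1}+\frac{2}{y+2}+\frac{2}{x+y}$. For all integers $x,y\ge 2$, $f(x,y)\ge -\frac{31}{105}$. -}

module Defs where

open import Data.Nat using (ℕ; zero; suc)
open import Data.Integer using (+_)
open import Data.Rational using (ℚ; _/_; _+_; _-_; _*_; 0ℚ)

-- reciprocal 1/n of a natural number as a rational; the value at 0 is an
-- arbitrary convention (never used: all denominators below are ≥ 2 under the
-- hypotheses x, y ≥ 2).
inv : ℕ → ℚ
inv zero    = 0ℚ
inv (suc n) = (+ 1) / suc n

c : ℕ → ℚ
c n = (+ n) / 1

f : ℕ → ℕ → ℚ
f x y = c 4 * inv x - c 8 * inv (x Data.Nat.+ 1) + c 2 * inv (x Data.Nat.+ 2)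
      + c 4 * inv y - c 8 * inv (y Data.Nat.+ 1) + c 2 * inv (y Data.Nat.+ 2)
      + c 2 * inv (x Data.Nat.+ y)

-- Split f(x,y) = g(x) + g(y) + 2/(x+y) with g(x) = 4/x - 8/(x+1) + 2/(x+2). Since
-- 1/n - 1/(n+1) = 1/(n(n+1)), g(x) + 2/x = (2/(x+1)) (2/x + 1/(x(x+1)) + 1/((x+1)(x+2))) ≥ 0,
-- so f(x,y) ≥ -2/x - 2/y, which settles x, y ≥ 14 as 4/14 < 31/105. By symmetry the remaining
-- case is 2 ≤ x ≤ 13: for y ≤ 70 the bound is checked by evaluation, and for y ≥ 71 it follows
-- from g(x) ≥ -4/15 (again checked by evaluation) and -4/15 - 2/71 > -31/105.
module Submission where

open import Data.Integer as ℤ using (+_; -[1+_])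
open import Data.Integer.Tactic.RingSolver using (solve-∀)
open import Data.Nat as ℕ using (ℕ; suc; s≤s; z≤n)
open import Data.Nat.Properties as ℕ using (allUpTo?)
open import Data.Rational
open import Data.Rational.Properties
import Data.Rational.Solver as Solver
open import Data.Rational.Unnormalised as ℚᵘ using (mkℚᵘ; *≡*; *≤*)
import Data.Rational.Unnormalised.Properties as ℚᵘ
open import Relation.Binary.PropositionalEquality
open import Relation.Nullary.Decidable using (yes; no; toWitness)

open import Defs

toℚᵘ-inv-suc : ∀ n → toℚᵘ (inv (suc n)) ℚᵘ.≃ mkℚᵘ (+ 1) n
toℚᵘ-inv-suc n = toℚᵘ-fromℚᵘ (mkℚᵘ (+ 1) n)

inv-nonNeg : ∀ n → 0ℚ ≤ inv n
inv-nonNeg 0       = ≤-refl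
inv-nonNeg (suc n) = nonNegative⁻¹ (inv (suc n)) {{normalize-nonNeg 1 (suc n)}}

*-nonNeg : ∀ {p q} → 0ℚ ≤ p → 0ℚ ≤ q → 0ℚ ≤ p * q
*-nonNeg {p} {q} 0≤p 0≤q = nonNegative⁻¹ (p * q) {{nonNeg*nonNeg⇒nonNeg p {{nonNegative 0≤p}} q {{nonNegative 0≤q}}}}

inv-suc-antimono : ∀ {m n} → m ℕ.≤ n → inv (suc n) ≤ inv (suc m)
inv-suc-antimono {m} {n} m≤n = toℚᵘ-cancel-≤
  (ℚᵘ.≤-respʳ-≃ (ℚᵘ.≃-sym (toℚᵘ-inv-suc m)) (ℚᵘ.≤-respˡ-≃ (ℚᵘ.≃-sym (toℚᵘ-inv-suc n))
     (*≤* (ℤ.+≤+ (ℕ.*-monoʳ-≤ 1 (s≤s m≤n))))))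

inv-suc-difference : ∀ n → inv (suc n) - inv (suc (suc n)) ≡ inv (suc n) * inv (suc (suc n))
inv-suc-difference n = toℚᵘ-injective (begin-equality
  toℚᵘ (a - b)                           ≃⟨ toℚᵘ-homo-+ a (- b) ⟩
  toℚᵘ a ℚᵘ.+ toℚᵘ (- b)                 ≃⟨ ℚᵘ.+-congʳ (toℚᵘ a) (toℚᵘ-homo‿- b) ⟩
  toℚᵘ a ℚᵘ.- toℚᵘ b                     ≃⟨ ℚᵘ.+-cong (toℚᵘ-inv-suc n) (ℚᵘ.-‿cong (toℚᵘ-inv-suc (suc n))) ⟩
  mkℚᵘ (+ 1) n ℚᵘ.- mkℚᵘ (+ 1) (suc n)   ≃⟨ *≡* (cross-multiplied (+ n)) ⟩
  mkℚᵘ (+ 1) n ℚᵘ.* mkℚᵘ (+ 1) (suc n)   ≃⟨ ℚᵘ.*-cong (toℚᵘ-inv-suc n) (toℚᵘ-inv-suc (suc n)) ⟨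
  toℚᵘ a ℚᵘ.* toℚᵘ b                     ≃⟨ toℚᵘ-homo-* a b ⟨
  toℚᵘ (a * b)                           ∎)
  where
  open ℚᵘ.≤-Reasoning
  a = inv (suc n)
  b = inv (suc (suc n))
  cross-multiplied : ∀ N → (+ 1 ℤ.* (+ 2 ℤ.+ N) ℤ.+ ℤ.- (+ 1) ℤ.* (+ 1 ℤ.+ N)) ℤ.* ((+ 1 ℤ.+ N) ℤ.* (+ 2 ℤ.+ N))
                   ≡ (+ 1 ℤ.* + 1) ℤ.* ((+ 1 ℤ.+ N) ℤ.* (+ 2 ℤ.+ N))
  cross-multiplied = solve-∀

g : ℕ → ℚ
g x = c 4 * inv x - c 8 * inv (x ℕ.+ 1) + c 2 * inv (x ℕ.+ 2)

f-split : ∀ x y → f x y ≡ g x + g y + c 2 * inv (x ℕ.+ y)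
f-split x y = solve 7
  (λ p q r s t u v → p :- q :+ r :+ s :- t :+ u :+ v := (p :- q :+ r) :+ (s :- t :+ u) :+ v) refl
  (c 4 * inv x) (c 8 * inv (x ℕ.+ 1)) (c 2 * inv (x ℕ.+ 2))
  (c 4 * inv y) (c 8 * inv (y ℕ.+ 1)) (c 2 * inv (y ℕ.+ 2)) (c 2 * inv (x ℕ.+ y))
  where open Solver.+-*-Solver

f-comm : ∀ x y → f x y ≡ f y x
f-comm x y = begin
  f x y                              ≡⟨ f-split x y ⟩
  g x + g y + c 2 * inv (x ℕ.+ y)    ≡⟨ cong₂ _+_ (+-comm (g x) (g y)) (cong (λ n → c 2 * inv n) (ℕ.+-comm x y)) ⟩
  g y + g x + c 2 * inv (y ℕ.+ x)    ≡⟨ f-split y x ⟨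
  f y x                              ∎
  where open ≡-Reasoning

-- a, b, d stand for 1/x, 1/(x+1), 1/(x+2).
g-decomposition : ∀ a b d → a - b ≡ a * b → b - d ≡ b * d →
         c 4 * a - c 8 * b + c 2 * d ≡ - (c 2 * a) + c 2 * b * (a + a + a * b + b * d)
g-decomposition a b d a-b≡ab b-d≡bd = begin
  (w + w) * a - (w + w + w + w) * b + w * d
    ≡⟨ solve 4 (λ w a b d → (w :+ w) :* a :- (w :+ w :+ w :+ w) :* b :+ w :* d
                          := :- (w :* a) :+ w :* ((a :- b) :+ (a :- b) :+ (a :- b) :- (b :- d))) refl w a b d ⟩
  - (w * a) + w * ((a - b) + (a - b) + (a - b) - (b - d))
    ≡⟨ cong₂ (λ p q → - (w * a) + w * (p + p + p - q)) a-b≡ab b-d≡bd ⟩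
  - (w * a) + w * (a * b + a * b + a * b - b * d)
    ≡⟨ solve 4 (λ w a b d → :- (w :* a) :+ w :* (a :* b :+ a :* b :+ a :* b :- b :* d)
                          := :- (w :* a) :+ w :* b :* (a :+ a :+ (a :- b) :+ (b :- d))) refl w a b d ⟩
  - (w * a) + w * b * (a + a + (a - b) + (b - d))
    ≡⟨ cong₂ (λ p q → - (w * a) + w * b * (a + a + p + q)) a-b≡ab b-d≡bd ⟩
  - (w * a) + w * b * (a + a + a * b + b * d)
    ∎
  where
  open ≡-Reasoning
  open Solver.+-*-Solver
  w = c 2

g-suc : ∀ n → g (suc n) ≡ c 4 * inv (suc n) - c 8 * inv (suc (suc n)) + c 2 * inv (suc (suc (suc n)))
g-suc n = cong₂ (λ p q → c 4 * inv (suc n) - c 8 * inv p + c 2 * inv q) (ℕ.+-comm (suc n) 1) (ℕ.+-comm (suc n) 2)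

g≥-2/x : ∀ n → - (c 2 * inv (suc n)) ≤ g (suc n)
g≥-2/x n = begin
  - (c 2 * a)                                      ≡⟨ +-identityʳ (- (c 2 * a)) ⟨
  - (c 2 * a) + 0ℚ                                 ≤⟨ +-monoʳ-≤ (- (c 2 * a)) 0≤rest ⟩
  - (c 2 * a) + c 2 * b * (a + a + a * b + b * d)  ≡⟨ g-decomposition a b d (inv-suc-difference n) (inv-suc-difference (suc n)) ⟨
  c 4 * a - c 8 * b + c 2 * d                      ≡⟨ g-suc n ⟨
  g (suc n)                                        ∎
  where
  open ≤-Reasoning
  a = inv (suc n)
  b = inv (suc (suc n))
  d = inv (suc (suc (suc n)))
  0≤a = inv-nonNeg (suc n)
  0≤b = inv-nonNeg (suc (suc n))
  0≤rest : 0ℚ ≤ c 2 * b * (a + a + a * b + b * d)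
  0≤rest = *-nonNeg (*-nonNeg (nonNegative⁻¹ (c 2)) 0≤b)
    (+-mono-≤ (+-mono-≤ (+-mono-≤ 0≤a 0≤a) (*-nonNeg 0≤a 0≤b)) (*-nonNeg 0≤b (inv-nonNeg (suc (suc (suc n))))))

g≥-2/k : ∀ {k x} → suc k ℕ.≤ x → - (c 2 * inv (suc k)) ≤ g x
g≥-2/k {k} {suc m} (s≤s k≤m) = begin
  - (c 2 * inv (suc k))  ≤⟨ neg-antimono-≤ (*-monoˡ-≤-nonNeg (c 2) (inv-suc-antimono k≤m)) ⟩
  - (c 2 * inv (suc m))  ≤⟨ g≥-2/x m ⟩
  g (suc m)              ∎
  where open ≤-Reasoning

f-lower-bound : ∀ x y {A B} → A ≤ g x → B ≤ g y → A + B ≤ f x y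
f-lower-bound x y {A} {B} A≤gx B≤gy = begin
  A + B                              ≡⟨ +-identityʳ (A + B) ⟨
  A + B + 0ℚ                         ≤⟨ +-mono-≤ (+-mono-≤ A≤gx B≤gy) 0≤2/[x+y] ⟩
  g x + g y + c 2 * inv (x ℕ.+ y)    ≡⟨ f-split x y ⟨
  f x y                              ∎
  where
  open ≤-Reasoning
  0≤2/[x+y] = *-nonNeg (nonNegative⁻¹ (c 2)) (inv-nonNeg (x ℕ.+ y))

f-bound-grid : ∀ {i} → i ℕ.< 12 → ∀ {j} → j ℕ.< 69 → -[1+ 30 ] / 105 ≤ f (2 ℕ.+ i) (2 ℕ.+ j)
f-bound-grid = toWitness {a? = allUpTo? (λ i → allUpTo? (λ j → -[1+ 30 ] / 105 ≤? f (2 ℕ.+ i) (2 ℕ.+ j)) 69) 12} _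

g-bound-grid : ∀ {i} → i ℕ.< 12 → -[1+ 3 ] / 15 ≤ g (2 ℕ.+ i)
g-bound-grid = toWitness {a? = allUpTo? (λ i → -[1+ 3 ] / 15 ≤? g (2 ℕ.+ i)) 12} _

f-bound-small : ∀ {x y} → 2 ℕ.≤ x → x ℕ.≤ 13 → 2 ℕ.≤ y → -[1+ 30 ] / 105 ≤ f x y
f-bound-small {suc (suc i)} {suc (suc j)} (s≤s (s≤s z≤n)) (s≤s (s≤s i≤11)) (s≤s (s≤s z≤n)) with j ℕ.<? 69
... | yes j<69 = f-bound-grid (s≤s i≤11) j<69
... | no  j≮69 = begin
  -[1+ 30 ] / 105                   ≤⟨ ≤ᵇ⇒≤ _ ⟩
  -[1+ 3 ] / 15 + - (c 2 * inv 71)  ≤⟨ f-lower-bound (2 ℕ.+ i) (2 ℕ.+ j)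
                                          (g-bound-grid (s≤s i≤11)) (g≥-2/k (s≤s (s≤s (ℕ.≮⇒≥ j≮69)))) ⟩
  f (2 ℕ.+ i) (2 ℕ.+ j)             ∎
  where open ≤-Reasoning

f-bound-large : ∀ {x y} → 14 ℕ.≤ x → 14 ℕ.≤ y → -[1+ 30 ] / 105 ≤ f x y
f-bound-large {x} {y} 14≤x 14≤y = begin
  -[1+ 30 ] / 105                      ≤⟨ ≤ᵇ⇒≤ _ ⟩
  - (c 2 * inv 14) + - (c 2 * inv 14)  ≤⟨ f-lower-bound x y (g≥-2/k 14≤x) (g≥-2/k 14≤y) ⟩
  f x y                                ∎
  where open ≤-Reasoning

lemma2 : (x y : ℕ) → 2 ℕ.≤ x → 2 ℕ.≤ y → -[1+ 30 ] / 105 ≤ f x y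
lemma2 x y 2≤x 2≤y with x ℕ.≤? 13 | y ℕ.≤? 13
... | yes x≤13 | _        = f-bound-small 2≤x x≤13 2≤y
... | no _     | yes y≤13 = subst (-[1+ 30 ] / 105 ≤_) (f-comm y x) (f-bound-small 2≤y y≤13 2≤x)
... | no x≰13  | no y≰13  = f-bound-large (ℕ.≰⇒> x≰13) (ℕ.≰⇒> y≰13)
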